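{- Let $G$ be a digraph on $n$ vertices and let $\delta = \delta^+(G)/n$. Suppose that $X \subseteq V(G)$ is weakly connected in $G$ and $\mathcal{K}_{3,1}(G[X]) \neq \emptyset$. Let $z \in V(G)$ be such that $|N^+(z) \cap X| \ge 2 (1-\delta) n$. Then $\{z\} \cup X$ is weakly connected in $G$.
   Context: A digraph has no loops and at most one arc from $x$ to $y$ for each ordered pair $(x,y)$ (arcs in both directions are allowed). $N^+(v)$, $N^-(v)$ are the out- and in-neighbourhoods and $\delta^+(G)$ the minimum out-degree. The base graph of a digraph is the undirected graph with an edge $xy$ whenever $xy$ or $yx$ is an arc. $\mathcal{K}_{3,1}(G)$ is the set of subdigraphs of $G$ on $3$ vertices whose base graph is a triangle and whose minimum out-degree (within the subdigraph) is at least $1$; for a 3-set $S$ we write $G[S] \in \mathcal{K}_{3,1}(G)$ if the induced subdigraph has this property. Two vertices $x,x'$ are weakly $s$-connected if there is a vertex multiset $W$ with $|W| = 3s-1$ such that each of the multisets $\{x\} \cup W$ and $\{x'\} \cup W$ can be partitioned into $S_1,\dots,S_s$ where each $S_i$ consists of three distinct vertices with $G[S_i] \in \mathcal{K}_{3,1}(G)$. A set $U \subseteq V(G)$ is weakly $s$-connected in $G$ if every pair of vertices of $U$ is weakly $s$-connected, and weakly connected if it is weakly $s$-connected for some $s \in \mathbb{N}$. -}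

module Defs where

open import Data.Nat using (ℕ; zero; suc; _+_; _*_; _∸_; _≤_; _⊓_)
open import Data.Fin using (Fin; _≟_)
import Data.Fin as Fin
open import Relation.Nullary using (yes; no)
open import Data.Bool using (Bool; true; false; _∧_)
open import Data.List using (List; []; _∷_; length; filterᵇ; allFin; map; foldr; concatMap)
open import Data.List.Relation.Binary.Permutation.Propositional using (_↭_)
open import Data.Product using (Σ; ∃; ∃-syntax; _×_; _,_)
open import Data.Sum using (_⊎_)
open import Relation.Binary.PropositionalEquality using (_≡_; _≢_)

-- A digraph on vertex set Fin n: no loops; at most one arc x→y per ordered
-- pair is automatic since arcs are given by a Boolean relation.
record Digraph (n : ℕ) : Set where
  field
    arc      : Fin n → Fin n → Bool
    loopless : ∀ v → arc v v ≡ false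
open Digraph public

VSet : ℕ → Set
VSet n = Fin n → Bool

_∈ᵥ_ : ∀ {n} → Fin n → VSet n → Set
v ∈ᵥ X = X v ≡ true

card : ∀ {n} → VSet n → ℕ
card {n} X = length (filterᵇ X (allFin n))

N⁺ : ∀ {n} → Digraph n → Fin n → VSet n
N⁺ G v = arc G v

outdeg : ∀ {n} → Digraph n → Fin n → ℕ
outdeg G v = card (N⁺ G v)

-- minimum out-degree δ⁺(G) (0 for the empty digraph)
δ⁺ : ∀ {n} → Digraph n → ℕ
δ⁺ {zero}  G = 0
δ⁺ {suc m} G = foldr _⊓_ (outdeg G Fin.zero) (map (outdeg G) (allFin (suc m)))

_∩ᵥ_ : ∀ {n} → VSet n → VSet n → VSet n
(X ∩ᵥ Y) v = X v ∧ Y v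

insertᵥ : ∀ {n} → Fin n → VSet n → VSet n
insertᵥ z X v with z ≟ v
... | yes _ = true
... | no _ = X v

Adj : ∀ {n} → Digraph n → Fin n → Fin n → Set
Adj G x y = (arc G x y ≡ true) ⊎ (arc G y x ≡ true)

HasOutIn : ∀ {n} → Digraph n → Fin n → Fin n → Fin n → Set
HasOutIn G x y z = (arc G x y ≡ true) ⊎ (arc G x z ≡ true)

InK31 : ∀ {n} → Digraph n → Fin n → Fin n → Fin n → Set
InK31 G a b c =
  (a ≢ b) × (a ≢ c) × (b ≢ c) ×
  Adj G a b × Adj G a c × Adj G b c ×
  HasOutIn G a b c × HasOutIn G b a c × HasOutIn G c a b

Triple : ℕ → Set
Triple n = Fin n × Fin n × Fin n

InK31ᵗ : ∀ {n} → Digraph n → Triple n → Set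
InK31ᵗ G (a , b , c) = InK31 G a b c

tripleList : ∀ {n} → Triple n → List (Fin n)
tripleList (a , b , c) = a ∷ b ∷ c ∷ []

data AllL {A : Set} (P : A → Set) : List A → Set where
  []  : AllL P []
  _∷_ : ∀ {x xs} → P x → AllL P xs → AllL P (x ∷ xs)

-- the multiset M (a list, up to permutation) can be partitioned into
-- s triples each inducing a member of 𝒦_{3,1}(G)
Partitionable : ∀ {n} → Digraph n → ℕ → List (Fin n) → Set
Partitionable {n} G s M =
  Σ (List (Triple n)) λ Ts →
    (length Ts ≡ s) × AllL (InK31ᵗ G) Ts × (concatMap tripleList Ts ↭ M)

WeaklySConn : ∀ {n} → Digraph n → ℕ → Fin n → Fin n → Set
WeaklySConn {n} G s x x' =
  Σ (List (Fin n)) λ W →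
    (length W + 1 ≡ 3 * s) ×
    Partitionable G s (x ∷ W) × Partitionable G s (x' ∷ W)

WeaklySConnSet : ∀ {n} → Digraph n → ℕ → VSet n → Set
WeaklySConnSet G s U = ∀ x x' → x ∈ᵥ U → x' ∈ᵥ U → WeaklySConn G s x x'

WeaklyConnSet : ∀ {n} → Digraph n → VSet n → Set
WeaklyConnSet G U = ∃[ s ] WeaklySConnSet G s U

K31NonEmptyIn : ∀ {n} → Digraph n → VSet n → Set
K31NonEmptyIn G X =
  Σ _ λ a → Σ _ λ b → Σ _ λ c → a ∈ᵥ X × b ∈ᵥ X × c ∈ᵥ X × InK31 G a b c

{-# OPTIONS --safe #-}
module Submission where

-- Write m = n ∸ δ⁺(G).  Every vertex misses at most m vertices (itself included), so inside
-- Y = N⁺(z) ∩ X, of size k ≥ 2m, every vertex has at least k ∸ m ≥ k/2 out-neighbours.  Counting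
-- ordered pairs of Y then shows that G[Y] has more arcs than Y has unordered pairs of distinct
-- vertices, so it contains a 2-cycle a ⇄ b, and {z, a, b} ∈ 𝒦₃,₁(G).  If X is weakly s-connected
-- and {p, q, r} ∈ 𝒦₃,₁(G[X]), trading a, b for q, r through a ~ q and b ~ r connects z to p at
-- level 2s + 1, hence to all of X at level 3s + 1; padding with copies of {z, a, b} lifts the
-- connections inside X to the same level.

open import Defs
open import Data.Nat using (ℕ; zero; suc; _+_; _*_; _∸_; _⊓_; _≤_; _<_; z≤n; s≤s)
open import Data.Fin using (Fin; _≟_)
open import Data.Bool using (Bool; true; false; not; T?)
import Data.Bool.Properties as Bool
open import Data.Empty using (⊥-elim)
open import Data.List using (List; []; _∷_; [_]; _++_; length; filterᵇ; allFin; foldr; concatMap)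
open import Data.List.Properties using (length-++; length-tabulate; concatMap-++)
open import Data.List.Membership.Propositional using (_∈_; find; lose)
open import Data.List.Membership.Propositional.Properties using (∈-allFin; ∈-map⁺; ∈-filter⁻)
open import Data.List.Relation.Binary.Permutation.Propositional
  using (_↭_; ↭-refl; ↭-trans; ↭-reflexive; prep)
open import Data.List.Relation.Binary.Permutation.Propositional.Properties
  using (++⁺; ↭-length; shift; ++-commutativeMonoid)
open import Data.List.Relation.Unary.Any using (here; there; any?)
open import Data.Nat.Properties hiding (_≟_)
open import Algebra.Properties.CommutativeSemigroup +-commutativeSemigroup
  using (interchange) renaming (x∙yz≈y∙xz to m+[n+o]≡n+[m+o])
open import Algebra.Properties.CommutativeSemigroup *-commutativeSemigroup
  using () renaming (x∙yz≈y∙xz to m*[n*o]≡n*[m*o])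
open import Data.Product using (∃₂; _×_; _,_; proj₂)
open import Data.Sum using (_⊎_; inj₁; inj₂)
open import Function using (_∘_; Equivalence)
open import Relation.Nullary using (Dec; ¬_; yes; no; _×-dec_; contradiction)
open import Relation.Binary.PropositionalEquality
  using (_≡_; _≢_; refl; sym; trans; cong; cong₂; module ≡-Reasoning)

⟦_⟧ : Bool → ℕ
⟦ true ⟧  = 1
⟦ false ⟧ = 0

⟦u⟧+⟦v⟧≤1 : ∀ {u v} → ¬ (u ≡ true × v ≡ true) → ⟦ u ⟧ + ⟦ v ⟧ ≤ 1
⟦u⟧+⟦v⟧≤1 {true}  {true}  ¬both = ⊥-elim (¬both (refl , refl))
⟦u⟧+⟦v⟧≤1 {true}  {false} _     = ≤-refl
⟦u⟧+⟦v⟧≤1 {false} {true}  _     = ≤-refl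
⟦u⟧+⟦v⟧≤1 {false} {false} _     = z≤n

module _ {A : Set} where

  ∑ : List A → (A → ℕ) → ℕ
  ∑ []       f = 0
  ∑ (x ∷ xs) f = f x + ∑ xs f

  syntax ∑ xs (λ x → e) = ∑[ x ∈ xs ] e

  ∑-cong : ∀ xs {f g : A → ℕ} → (∀ x → f x ≡ g x) → ∑ xs f ≡ ∑ xs g
  ∑-cong []       f≡g = refl
  ∑-cong (x ∷ xs) f≡g = cong₂ _+_ (f≡g x) (∑-cong xs f≡g)

  ∑-mono : ∀ xs {f g : A → ℕ} → (∀ {x} → x ∈ xs → f x ≤ g x) → ∑ xs f ≤ ∑ xs g
  ∑-mono []       f≤g = z≤n
  ∑-mono (x ∷ xs) f≤g = +-mono-≤ (f≤g (here refl)) (∑-mono xs (f≤g ∘ there))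

  ∑-const : ∀ xs c → ∑[ _ ∈ xs ] c ≡ length xs * c
  ∑-const []       c = refl
  ∑-const (x ∷ xs) c = cong (c +_) (∑-const xs c)

  ∑-+ : ∀ xs (f g : A → ℕ) → ∑[ x ∈ xs ] (f x + g x) ≡ ∑ xs f + ∑ xs g
  ∑-+ []       f g = refl
  ∑-+ (x ∷ xs) f g =
    trans (cong (f x + g x +_) (∑-+ xs f g)) (interchange (f x) (g x) (∑ xs f) (∑ xs g))

  ∑-suc : ∀ xs (f : A → ℕ) → ∑[ x ∈ xs ] suc (f x) ≡ length xs + ∑ xs f
  ∑-suc []       f = refl
  ∑-suc (x ∷ xs) f = cong suc (trans (cong (f x +_) (∑-suc xs f)) (m+[n+o]≡n+[m+o] (f x) (length xs) _))

  ∑-swap : ∀ xs ys (f : A → A → ℕ) → ∑[ x ∈ xs ] ∑[ y ∈ ys ] f x y ≡ ∑[ y ∈ ys ] ∑[ x ∈ xs ] f x y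
  ∑-swap []       ys f = sym (trans (∑-const ys 0) (*-zeroʳ (length ys)))
  ∑-swap (x ∷ xs) ys f =
    trans (cong (∑ ys (f x) +_) (∑-swap xs ys f)) (sym (∑-+ ys (f x) (λ y → ∑[ x′ ∈ xs ] f x′ y)))

  ∈⇒≤∑ : ∀ {xs} (f : A → ℕ) {x} → x ∈ xs → f x ≤ ∑ xs f
  ∈⇒≤∑ f (here refl) = m≤m+n _ _
  ∈⇒≤∑ f (there x∈xs) = ≤-trans (∈⇒≤∑ f x∈xs) (m≤n+m _ _)

  ∑≤length : ∀ {xs} {f : A → ℕ} → (∀ {y} → y ∈ xs → f y ≤ 1) → ∑ xs f ≤ length xs
  ∑≤length {xs} f≤1 = ≤-trans (∑-mono xs f≤1) (≤-reflexive (trans (∑-const xs 1) (*-identityʳ _)))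

  ∑<length : ∀ {xs} {f : A → ℕ} {x} → (∀ {y} → y ∈ xs → f y ≤ 1) → x ∈ xs → f x ≡ 0 → ∑ xs f < length xs
  ∑<length {xs = _ ∷ xs} {f} f≤1 (here refl) fx≡0 =
    s≤s (≤-trans (≤-reflexive (cong (_+ ∑ xs f) fx≡0)) (∑≤length (f≤1 ∘ there)))
  ∑<length f≤1 (there x∈xs) fx≡0 =
    ≤-trans (≤-reflexive (sym (+-suc _ _))) (+-mono-≤ (f≤1 (here refl)) (∑<length (f≤1 ∘ there) x∈xs fx≡0))

  ∑-filterᵇ-≤ : ∀ (p : A → Bool) xs (f : A → ℕ) → ∑ (filterᵇ p xs) f ≤ ∑ xs f
  ∑-filterᵇ-≤ p []       f = z≤n
  ∑-filterᵇ-≤ p (x ∷ xs) f with p x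
  ... | true  = +-monoʳ-≤ (f x) (∑-filterᵇ-≤ p xs f)
  ... | false = ≤-trans (∑-filterᵇ-≤ p xs f) (m≤n+m _ (f x))

  length-filterᵇ : ∀ (p : A → Bool) xs → length (filterᵇ p xs) ≡ ∑[ x ∈ xs ] ⟦ p x ⟧
  length-filterᵇ p []       = refl
  length-filterᵇ p (x ∷ xs) with p x
  ... | true  = cong suc (length-filterᵇ p xs)
  ... | false = length-filterᵇ p xs

  ∑⟦p⟧+∑⟦not∘p⟧≡length : ∀ (p : A → Bool) xs → ∑[ x ∈ xs ] ⟦ p x ⟧ + ∑[ x ∈ xs ] ⟦ not (p x) ⟧ ≡ length xs
  ∑⟦p⟧+∑⟦not∘p⟧≡length p []       = refl
  ∑⟦p⟧+∑⟦not∘p⟧≡length p (x ∷ xs) with p x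
  ... | true  = cong suc (∑⟦p⟧+∑⟦not∘p⟧≡length p xs)
  ... | false = trans (+-suc _ _) (cong suc (∑⟦p⟧+∑⟦not∘p⟧≡length p xs))

foldr-⊓-≤ : ∀ e {xs : List ℕ} {x} → x ∈ xs → foldr _⊓_ e xs ≤ x
foldr-⊓-≤ e (here refl)  = m⊓n≤m _ _
foldr-⊓-≤ e (there x∈xs) = ≤-trans (m⊓n≤n _ _) (foldr-⊓-≤ e x∈xs)

δ⁺≤outdeg : ∀ {n} (G : Digraph n) v → δ⁺ G ≤ outdeg G v
δ⁺≤outdeg {suc _} G v = foldr-⊓-≤ _ (∈-map⁺ (outdeg G) (∈-allFin v))

toList : ∀ {n} → VSet n → List (Fin n)
toList {n} U = filterᵇ U (allFin n)

∈-toList⁻ : ∀ {n} {U : VSet n} {a} → a ∈ toList U → a ∈ᵥ U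
∈-toList⁻ {n} {U} a∈U = Equivalence.to Bool.T-≡ (proj₂ (∈-filter⁻ (T? ∘ U) {xs = allFin n} a∈U))

∈-insertᵥ⁻ : ∀ {n} {z} {X : VSet n} {x} → x ∈ᵥ insertᵥ z X → z ≡ x ⊎ x ∈ᵥ X
∈-insertᵥ⁻ {z = z} {x = x} x∈zX with z ≟ x
... | yes z≡x = inj₁ z≡x
... | no _    = inj₂ x∈zX

∈-∩ᵥ⁻ : ∀ {n} {U V : VSet n} {a} → a ∈ᵥ (U ∩ᵥ V) → a ∈ᵥ U × a ∈ᵥ V
∈-∩ᵥ⁻ {U = U} {V} {a} a∈U∩V with U a | V a
... | true | true = refl , refl

m≤2[m∸n] : ∀ {m n} → 2 * n ≤ m → m ≤ 2 * (m ∸ n)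
m≤2[m∸n] {m} {n} 2n≤m = begin
  m           ≤⟨ m+n≤o⇒m≤o∸n m m+2n≤2m ⟩
  2 * m ∸ 2 * n ≡⟨ *-distribˡ-∸ 2 m n ⟨
  2 * (m ∸ n) ∎
  where
  open ≤-Reasoning
  m+2n≤2m : m + 2 * n ≤ 2 * m
  m+2n≤2m = ≤-trans (+-monoʳ-≤ m 2n≤m) (≤-reflexive (cong (m +_) (sym (+-identityʳ m))))

module _ {n : ℕ} (G : Digraph n) where

  arc⇒≢ : ∀ {u v} → arc G u v ≡ true → u ≢ v
  arc⇒≢ {u} u→v refl = contradiction (trans (sym u→v) (loopless G u)) λ ()

  nonOutdeg : Fin n → ℕ
  nonOutdeg a = ∑[ b ∈ allFin n ] ⟦ not (arc G a b) ⟧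

  outdeg+nonOutdeg≡n : ∀ a → outdeg G a + nonOutdeg a ≡ n
  outdeg+nonOutdeg≡n a = begin
    outdeg G a + nonOutdeg a                  ≡⟨ cong (_+ nonOutdeg a) (length-filterᵇ (arc G a) (allFin n)) ⟩
    ∑[ b ∈ allFin n ] ⟦ arc G a b ⟧ + nonOutdeg a ≡⟨ ∑⟦p⟧+∑⟦not∘p⟧≡length (arc G a) (allFin n) ⟩
    length (allFin n)                         ≡⟨ length-tabulate _ ⟩
    n                                         ∎
    where open ≡-Reasoning

  0<nonOutdeg : ∀ a → 0 < nonOutdeg a
  0<nonOutdeg a = ≤-trans (≤-reflexive (cong (λ u → ⟦ not u ⟧) (sym (loopless G a))))
                          (∈⇒≤∑ (λ b → ⟦ not (arc G a b) ⟧) (∈-allFin a))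

  δ⁺<n : Fin n → δ⁺ G < n
  δ⁺<n a = begin-strict
    δ⁺ G                     ≤⟨ δ⁺≤outdeg G a ⟩
    outdeg G a               <⟨ m<m+n _ (0<nonOutdeg a) ⟩
    outdeg G a + nonOutdeg a ≡⟨ outdeg+nonOutdeg≡n a ⟩
    n                        ∎
    where open ≤-Reasoning

  nonOutdeg≤n∸δ⁺ : ∀ a → nonOutdeg a ≤ n ∸ δ⁺ G
  nonOutdeg≤n∸δ⁺ a = m+n≤o⇒m≤o∸n (nonOutdeg a) (begin
    nonOutdeg a + δ⁺ G       ≤⟨ +-monoʳ-≤ (nonOutdeg a) (δ⁺≤outdeg G a) ⟩
    nonOutdeg a + outdeg G a ≡⟨ +-comm (nonOutdeg a) (outdeg G a) ⟩
    outdeg G a + nonOutdeg a ≡⟨ outdeg+nonOutdeg≡n a ⟩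
    n                        ∎)
    where open ≤-Reasoning

  outdegIn : List (Fin n) → Fin n → ℕ
  outdegIn Y a = ∑[ b ∈ Y ] ⟦ arc G a b ⟧

  arcCount : List (Fin n) → ℕ
  arcCount Y = ∑[ a ∈ Y ] outdegIn Y a

  card≤outdegIn+n∸δ⁺ : ∀ U a → card U ≤ outdegIn (toList U) a + (n ∸ δ⁺ G)
  card≤outdegIn+n∸δ⁺ U a = begin
    card U                                                         ≡⟨ ∑⟦p⟧+∑⟦not∘p⟧≡length (arc G a) (toList U) ⟨
    outdegIn (toList U) a + ∑[ b ∈ toList U ] ⟦ not (arc G a b) ⟧  ≤⟨ +-monoʳ-≤ _ (∑-filterᵇ-≤ U (allFin n) _) ⟩
    outdegIn (toList U) a + nonOutdeg a                            ≤⟨ +-monoʳ-≤ _ (nonOutdeg≤n∸δ⁺ a) ⟩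
    outdegIn (toList U) a + (n ∸ δ⁺ G)                             ∎
    where open ≤-Reasoning

  TwoCycle : Fin n → Fin n → Set
  TwoCycle a b = arc G a b ≡ true × arc G b a ≡ true

  twoCycle? : ∀ a b → Dec (TwoCycle a b)
  twoCycle? a b = (arc G a b Bool.≟ true) ×-dec (arc G b a Bool.≟ true)

  module _ (Y : List (Fin n)) where

    ∑∑⟦arc⟧+⟦arc⟧≡2*arcCount : ∑[ a ∈ Y ] ∑[ b ∈ Y ] (⟦ arc G a b ⟧ + ⟦ arc G b a ⟧) ≡ 2 * arcCount Y
    ∑∑⟦arc⟧+⟦arc⟧≡2*arcCount = begin
      ∑[ a ∈ Y ] ∑[ b ∈ Y ] (⟦ arc G a b ⟧ + ⟦ arc G b a ⟧) ≡⟨ ∑-cong Y (λ a → ∑-+ Y _ _) ⟩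
      ∑[ a ∈ Y ] (outdegIn Y a + ∑[ b ∈ Y ] ⟦ arc G b a ⟧) ≡⟨ ∑-+ Y _ _ ⟩
      arcCount Y + ∑[ a ∈ Y ] ∑[ b ∈ Y ] ⟦ arc G b a ⟧     ≡⟨ cong (arcCount Y +_) (∑-swap Y Y _) ⟩
      arcCount Y + arcCount Y                              ≡⟨ cong (arcCount Y +_) (+-identityʳ _) ⟨
      2 * arcCount Y                                       ∎
      where open ≡-Reasoning

    -- For a ∈ Y every b ∈ Y contributes ⟦a→b⟧ + ⟦b→a⟧ ≤ 1, and b = a contributes 0 since G is
    -- loopless; the latter gives the extra + length Y.
    arcCount-bound : (∀ {a b} → a ∈ Y → b ∈ Y → ¬ TwoCycle a b) →
                     2 * arcCount Y + length Y ≤ length Y * length Y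
    arcCount-bound noCycle = begin
      2 * arcCount Y + k                                         ≡⟨ +-comm _ k ⟩
      k + 2 * arcCount Y                                         ≡⟨ cong (k +_) ∑∑⟦arc⟧+⟦arc⟧≡2*arcCount ⟨
      k + ∑[ a ∈ Y ] ∑[ b ∈ Y ] (⟦ arc G a b ⟧ + ⟦ arc G b a ⟧)  ≡⟨ ∑-suc Y _ ⟨
      ∑[ a ∈ Y ] suc (∑[ b ∈ Y ] (⟦ arc G a b ⟧ + ⟦ arc G b a ⟧)) ≤⟨ ∑-mono Y (λ a∈Y → ∑<length (⟦u⟧+⟦v⟧≤1 ∘ noCycle a∈Y) a∈Y (noLoop _)) ⟩
      ∑[ _ ∈ Y ] k                                               ≡⟨ ∑-const Y k ⟩
      k * k                                                      ∎
      where
      open ≤-Reasoning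
      k = length Y
      noLoop : ∀ a → ⟦ arc G a a ⟧ + ⟦ arc G a a ⟧ ≡ 0
      noLoop a = cong (λ u → ⟦ u ⟧ + ⟦ u ⟧) (loopless G a)

    halfOutdegIn⇒twoCycle : ∀ d → 0 < length Y → length Y ≤ 2 * d → (∀ {a} → a ∈ Y → d ≤ outdegIn Y a) →
                            ∃₂ λ a b → a ∈ Y × b ∈ Y × TwoCycle a b
    halfOutdegIn⇒twoCycle d 0<k k≤2d d≤outdegIn with any? (λ a → any? (twoCycle? a) Y) Y
    ... | yes cycle =
      let a , a∈Y , cycleₐ = find cycle
          b , b∈Y , a⇄b    = find cycleₐ
      in a , b , a∈Y , b∈Y , a⇄b
    ... | no noCycle = contradiction tooManyArcs (<⇒≱ (m<m+n (2 * arcCount Y) 0<k))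
      where
      open ≤-Reasoning
      k = length Y
      tooManyArcs : 2 * arcCount Y + k ≤ 2 * arcCount Y
      tooManyArcs = begin
        2 * arcCount Y + k ≤⟨ arcCount-bound (λ a∈Y b∈Y a⇄b → noCycle (lose a∈Y (lose b∈Y a⇄b))) ⟩
        k * k             ≤⟨ *-monoʳ-≤ k k≤2d ⟩
        k * (2 * d)       ≡⟨ m*[n*o]≡n*[m*o] k 2 d ⟩
        2 * (k * d)       ≤⟨ *-monoʳ-≤ 2 (≤-trans (≤-reflexive (sym (∑-const Y d))) (∑-mono Y d≤outdegIn)) ⟩
        2 * arcCount Y    ∎

  largeSet⇒twoCycle : Fin n → ∀ U → 2 * (n ∸ δ⁺ G) ≤ card U → ∃₂ λ a b → a ∈ᵥ U × b ∈ᵥ U × TwoCycle a b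
  largeSet⇒twoCycle v U 2m≤k =
    let a , b , a∈U , b∈U , a⇄b =
          halfOutdegIn⇒twoCycle (toList U) (k ∸ m) 0<k (m≤2[m∸n] {k} {m} 2m≤k) k∸m≤outdegIn
    in a , b , ∈-toList⁻ a∈U , ∈-toList⁻ b∈U , a⇄b
    where
    m = n ∸ δ⁺ G
    k = card U
    0<k : 0 < k
    0<k = ≤-trans (m<n⇒0<n∸m (δ⁺<n v)) (≤-trans (m≤m+n m _) 2m≤k)
    k∸m≤outdegIn : ∀ {a} → a ∈ toList U → k ∸ m ≤ outdegIn (toList U) a
    k∸m≤outdegIn {a} _ = m≤n+o⇒m∸n≤o k m (≤-trans (card≤outdegIn+n∸δ⁺ U a) (≤-reflexive (+-comm _ m)))

  twoCycle⇒InK31 : ∀ {z a b} → arc G z a ≡ true → arc G z b ≡ true → TwoCycle a b → InK31 G z a b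
  twoCycle⇒InK31 z→a z→b (a→b , b→a) =
    arc⇒≢ z→a , arc⇒≢ z→b , arc⇒≢ a→b , inj₁ z→a , inj₁ z→b , inj₁ a→b ,
    inj₁ z→a , inj₂ a→b , inj₂ b→a

module _ {A : Set} where
  open import Algebra.Solver.CommutativeMonoid (++-commutativeMonoid {A = A})

  ↭-move : ∀ (y w : A) W₁ W₂ → (y ∷ W₁) ++ (w ∷ W₂) ↭ w ∷ W₁ ++ y ∷ W₂
  ↭-move y w W₁ W₂ =
    solve 4 (λ y w W₁ W₂ → (y ⊕ W₁) ⊕ (w ⊕ W₂) ⊜ w ⊕ (W₁ ⊕ (y ⊕ W₂))) ↭-refl [ y ] [ w ] W₁ W₂

  ↭-exchange : ∀ (x y x′ y′ : A) W₁ W₂ → x′ ∷ y′ ∷ (x ∷ W₁) ++ (y ∷ W₂) ↭ x ∷ y ∷ (x′ ∷ W₁) ++ (y′ ∷ W₂)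
  ↭-exchange x y x′ y′ W₁ W₂ =
    solve 6 (λ x y x′ y′ W₁ W₂ → x′ ⊕ (y′ ⊕ ((x ⊕ W₁) ⊕ (y ⊕ W₂))) ⊜ x ⊕ (y ⊕ ((x′ ⊕ W₁) ⊕ (y′ ⊕ W₂))))
      ↭-refl [ x ] [ y ] [ x′ ] [ y′ ] W₁ W₂

AllL-++ : ∀ {A : Set} {P : A → Set} {xs ys} → AllL P xs → AllL P ys → AllL P (xs ++ ys)
AllL-++ []         Pys = Pys
AllL-++ (Px ∷ Pxs) Pys = Px ∷ AllL-++ Pxs Pys

length-concatMap-tripleList : ∀ {n} (Ts : List (Triple n)) → length (concatMap tripleList Ts) ≡ 3 * length Ts
length-concatMap-tripleList []       = refl
length-concatMap-tripleList (T ∷ Ts) =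
  trans (cong (3 +_) (length-concatMap-tripleList Ts)) (sym (*-suc 3 (length Ts)))

module _ {n : ℕ} (G : Digraph n) where

  partitionable-length : ∀ {s M} → Partitionable G s M → length M ≡ 3 * s
  partitionable-length (Ts , refl , _ , Ts↭M) =
    trans (sym (↭-length Ts↭M)) (length-concatMap-tripleList Ts)

  partitionable-↭ : ∀ {s M M′} → M ↭ M′ → Partitionable G s M → Partitionable G s M′
  partitionable-↭ M↭M′ (Ts , ∣Ts∣≡s , K31s , Ts↭M) = Ts , ∣Ts∣≡s , K31s , ↭-trans Ts↭M M↭M′

  partitionable-++ : ∀ {s t M M′} → Partitionable G s M → Partitionable G t M′ → Partitionable G (s + t) (M ++ M′)
  partitionable-++ (Ts , refl , K31s , Ts↭M) (Ts′ , refl , K31s′ , Ts′↭M′) =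
    Ts ++ Ts′ , length-++ Ts , AllL-++ K31s K31s′ ,
    ↭-trans (↭-reflexive (concatMap-++ tripleList Ts Ts′)) (++⁺ Ts↭M Ts′↭M′)

  partitionable-triangle : ∀ {a b c} → InK31 G a b c → Partitionable G 1 (a ∷ b ∷ c ∷ [])
  partitionable-triangle {a} {b} {c} abc = (a , b , c) ∷ [] , refl , abc ∷ [] , ↭-refl

  -- The size condition |W| = 3s − 1 is forced by the partition of x ∪ W.
  weaklySConn-intro : ∀ {s x y W} → Partitionable G s (x ∷ W) → Partitionable G s (y ∷ W) → WeaklySConn G s x y
  weaklySConn-intro {W = W} P Q = W , trans (+-comm (length W) 1) (partitionable-length P) , P , Q

  weaklySConn-sym : ∀ {s x y} → WeaklySConn G s x y → WeaklySConn G s y x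
  weaklySConn-sym (W , ∣W∣ , P , Q) = W , ∣W∣ , Q , P

  weaklySConn-reflˡ : ∀ {s x y} → WeaklySConn G s x y → WeaklySConn G s x x
  weaklySConn-reflˡ (W , ∣W∣ , P , _) = W , ∣W∣ , P , P

  weaklySConn-trans : ∀ {s t x y w} → WeaklySConn G s x y → WeaklySConn G t y w → WeaklySConn G (s + t) x w
  weaklySConn-trans {y = y} {w} (W₁ , _ , Px , Py) (W₂ , _ , Py′ , Pw) =
    weaklySConn-intro (partitionable-++ Px Py′) (partitionable-↭ (↭-move y w W₁ W₂) (partitionable-++ Py Pw))

  weaklySConn-pad : ∀ {a b c x y s} → InK31 G a b c → ∀ j → WeaklySConn G s x y → WeaklySConn G (j + s) x y
  weaklySConn-pad abc zero    xy = xy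
  weaklySConn-pad {a} {b} {c} {s = s} abc (suc j) xy with weaklySConn-pad abc j xy
  ... | W , _ , Px , Py = weaklySConn-intro (addTriangle Px) (addTriangle Py)
    where
    addTriangle : ∀ {v} → Partitionable G (j + s) (v ∷ W) → Partitionable G (suc (j + s)) (v ∷ a ∷ b ∷ c ∷ W)
    addTriangle {v} P =
      partitionable-↭ (shift v (a ∷ b ∷ c ∷ []) W) (partitionable-++ (partitionable-triangle abc) P)

  -- Witness W = x y (x′ ∪ W₁) (y′ ∪ W₂): z ∪ W splits as zxy, x′ ∪ W₁, y′ ∪ W₂ and z′ ∪ W as z′x′y′, x ∪ W₁, y ∪ W₂.
  weaklySConn-exchange : ∀ {s t z x y z′ x′ y′} → InK31 G z x y → InK31 G z′ x′ y′ →
                         WeaklySConn G s x x′ → WeaklySConn G t y y′ → WeaklySConn G (1 + (s + t)) z z′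
  weaklySConn-exchange {x = x} {y} {z′} {x′} {y′} zxy z′x′y′ (W₁ , _ , Px , Px′) (W₂ , _ , Py , Py′) =
    weaklySConn-intro
      (partitionable-++ (partitionable-triangle zxy) (partitionable-++ Px′ Py′))
      (partitionable-↭ (prep z′ (↭-exchange x y x′ y′ W₁ W₂))
        (partitionable-++ (partitionable-triangle z′x′y′) (partitionable-++ Px Py)))

  module _ {s X z a b} (X-conn : WeaklySConnSet G s X) (K31[X] : K31NonEmptyIn G X)
           (zab : InK31 G z a b) (a∈X : a ∈ᵥ X) (b∈X : b ∈ᵥ X) where

    weaklySConn-apex : ∀ x → x ∈ᵥ X → WeaklySConn G (1 + (s + s) + s) z x
    weaklySConn-apex x x∈X =
      let p , q , r , p∈X , q∈X , r∈X , pqr = K31[X] in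
      weaklySConn-trans (weaklySConn-exchange zab pqr (X-conn a q a∈X q∈X) (X-conn b r b∈X r∈X)) (X-conn p x p∈X x∈X)

    weaklySConnSet-insertᵥ : WeaklySConnSet G (1 + (s + s) + s) (insertᵥ z X)
    weaklySConnSet-insertᵥ x x′ x∈ x′∈ with ∈-insertᵥ⁻ {z = z} {X} {x} x∈ | ∈-insertᵥ⁻ {z = z} {X} {x′} x′∈
    ... | inj₁ refl | inj₁ refl = weaklySConn-reflˡ (weaklySConn-apex a a∈X)
    ... | inj₁ refl | inj₂ x′∈X = weaklySConn-apex x′ x′∈X
    ... | inj₂ x∈X  | inj₁ refl = weaklySConn-sym (weaklySConn-apex x x∈X)
    ... | inj₂ x∈X  | inj₂ x′∈X = weaklySConn-pad zab (1 + (s + s)) (X-conn x x′ x∈X x′∈X)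

propositionA7 : (n : ℕ) (G : Digraph n) (X : VSet n) →
    WeaklyConnSet G X →
    K31NonEmptyIn G X →
    (z : Fin n) →
    2 * (n ∸ δ⁺ G) ≤ card (N⁺ G z ∩ᵥ X) →
    WeaklyConnSet G (insertᵥ z X)
propositionA7 n G X (s , X-conn) K31[X] z large =
  let a , b , a∈ , b∈ , a⇄b = largeSet⇒twoCycle G z (N⁺ G z ∩ᵥ X) large
      z→a , a∈X = ∈-∩ᵥ⁻ {U = N⁺ G z} {X} a∈
      z→b , b∈X = ∈-∩ᵥ⁻ {U = N⁺ G z} {X} b∈
  in _ , weaklySConnSet-insertᵥ G X-conn K31[X] (twoCycle⇒InK31 G z→a z→b a⇄b) a∈X b∈X
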